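{- There is a deterministic adaptive algorithm in the static multiple-access channel model (with collision detection) that finds a spanning forest $T$ of an input simple graph (with $n$ vertices and $m$ edges) in time $\mathcal{O}(\min\{m, |T|\log m\})$.
   Context: Model: the input is a simple graph $G$ (no edge weights) on vertex set $\{1,\dots,n\}$ with $m$ edges. There are $m$ stations with distinct IDs $1,\dots,m$; each station holds exactly one edge of $G$, and every edge is held by exactly one station. All stations know $n$; they do not know $m$. Computation is synchronous with a global clock. In each step every station either broadcasts a message (of arbitrary size) or not. If exactly one station broadcasts, its message is heard by all stations; if no station broadcasts, all stations hear silence; if two or more broadcast, all stations hear a collision signal distinct from silence (collision detection). In the static model all stations participate from the first step. An edge is revealed when it is heard on the channel. A spanning forest of $G$ is a maximal acyclic set of edges of $G$ (adding any further edge of $G$ creates a cycle); the algorithm finds a spanning forest $T$ if all edges of $T$ are revealed during the execution and then the execution terminates; $|T|$ is the number of edges of $T$. Time is the number of steps until termination. An algorithm is deterministic adaptive if each station's decision at each step is a deterministic function of $n$, its ID, its edge, and the channel feedback heard in previous steps. -}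

module Defs where

open import Data.Nat using (ℕ; zero; suc; _+_; _*_; _≤_; _<_)
open import Data.Fin using (Fin; toℕ) renaming (_<_ to _<ᶠ_)
open import Data.Bool using (Bool; true; false)
open import Data.List using (List; []; _∷_; _++_; [_]; length; map; allFin; filterᵇ)
open import Data.Product using (Σ; ∃; _×_; _,_; proj₁; proj₂)
open import Data.Sum using (_⊎_)
open import Data.List.Membership.Propositional using (_∈_)
open import Data.List.Relation.Unary.Unique.Propositional using (Unique)
open import Relation.Nullary using (¬_)
open import Relation.Binary.PropositionalEquality using (_≡_)
open import Function.Definitions using (Injective)

-- Graphs on vertex set {1..n}, represented as Fin n.
-- An (undirected) edge {u,v} is stored in normalised form (u , v), u < v.

Edge : ℕ → Set
Edge n = Fin n × Fin n

-- The input: m stations; station with ID (toℕ i + 1) holds edge E i.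
-- Simple graph: no loops, edges normalised (u < v), all distinct.
ValidInput : {n m : ℕ} → (Fin m → Edge n) → Set
ValidInput {n} {m} E =
  (∀ i → proj₁ (E i) <ᶠ proj₂ (E i)) × Injective _≡_ _≡_ E

InGraph : {n m : ℕ} → (Fin m → Edge n) → Edge n → Set
InGraph E e = ∃ λ i → E i ≡ e

Adj : {n : ℕ} → List (Edge n) → Fin n → Fin n → Set
Adj S u v = ((u , v) ∈ S) ⊎ ((v , u) ∈ S)

data Chain {n : ℕ} (S : List (Edge n)) : List (Fin n) → Set where
  nil  : Chain S []
  one  : ∀ u → Chain S [ u ]
  cons : ∀ {u v vs} → Adj S u v → Chain S (v ∷ vs) → Chain S (u ∷ v ∷ vs)

Cycle : {n : ℕ} → List (Edge n) → Set
Cycle {n} S = Σ (Fin n) λ v₀ → Σ (List (Fin n)) λ vs →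
  (2 ≤ length vs) × Unique (v₀ ∷ vs) × Chain S (v₀ ∷ vs ++ [ v₀ ])

Acyclic : {n : ℕ} → List (Edge n) → Set
Acyclic S = ¬ Cycle S

-- T (a duplicate-free list of edges) is a spanning forest of G:
-- a maximal acyclic subset of the edges of G.
SpanningForest : {n m : ℕ} → (Fin m → Edge n) → List (Edge n) → Set
SpanningForest E T =
  Unique T × (∀ e → e ∈ T → InGraph E e) × Acyclic T ×
  (∀ e → InGraph E e → ¬ (e ∈ T) → Cycle (e ∷ T))

-- Multiple-access channel with collision detection.
-- A successful broadcast is heard by all and carries the sender's ID
-- and edge (messages have arbitrary size).

data Feedback (n : ℕ) : Set where
  silence   : Feedback n
  collision : Feedback n
  heard     : ℕ → Edge n → Feedback n

-- channel history, most recent step first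
History : ℕ → Set
History n = List (Feedback n)

-- Deterministic adaptive algorithm: a station's decision to broadcast is
-- a function of n, its ID, its edge and the feedback heard so far (not m).
-- Termination is decided from common knowledge (n and the feedback).
record Algorithm : Set where
  field
    transmit : (n : ℕ) → (id : ℕ) → Edge n → History n → Bool
    halt     : (n : ℕ) → History n → Bool

open Algorithm public

transmitters : Algorithm → (n m : ℕ) → (Fin m → Edge n) → History n → List (ℕ × Edge n)
transmitters A n m E h =
  filterᵇ (λ p → transmit A n (proj₁ p) (proj₂ p) h)
          (map (λ i → (suc (toℕ i) , E i)) (allFin m))

channel : {n : ℕ} → List (ℕ × Edge n) → Feedback n
channel []                 = silence
channel ((i , e) ∷ [])     = heard i e
channel (_ ∷ _ ∷ _)        = collision

-- history after t steps of the static execution (all stations start at step 1)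
history : Algorithm → (n m : ℕ) → (Fin m → Edge n) → ℕ → History n
history A n m E zero    = []
history A n m E (suc t) =
  channel (transmitters A n m E (history A n m E t)) ∷ history A n m E t

TerminatesAt : Algorithm → (n m : ℕ) → (Fin m → Edge n) → ℕ → Set
TerminatesAt A n m E t =
  (halt A n (history A n m E t) ≡ true) ×
  (∀ t′ → t′ < t → halt A n (history A n m E t′) ≡ false)

Revealed : {n : ℕ} → Edge n → History n → Set
Revealed e h = ∃ λ i → heard i e ∈ h

module Submission where

-- The stations are scanned in increasing order of ID.  The history fixes a scan position L
-- and the list R of edges heard so far; a station is a candidate when its ID exceeds L and
-- its edge is not spanned by R.  A query of all candidates either ends the run (silence),
-- hears the first candidate, or collides; after a collision an exponential search over
-- blocks (L , L + 2 ^ j] and a binary search isolate the first candidate.  Hence every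
-- heard edge joins two components of R, all stations up to L stay spanned, and at the end
-- R is a maximal acyclic set.  Charging 3 steps per scanned ID and O(log m) steps per heard
-- edge gives the time bound.

open import Defs
open import Data.Nat using (ℕ; _+_; _*_; _≤_; _⊓_)
open import Data.Nat.Logarithm using (⌈log₂_⌉)
open import Data.Fin using (Fin)
open import Data.List using (List; length)
open import Data.Product using (Σ; ∃; _×_)
open import Data.List.Membership.Propositional using (_∈_)

open import Data.Nat using (zero; suc; _^_; _<_; s≤s; z≤n)
open import Data.Nat.Properties
open import Data.Nat.Logarithm using (⌈log₂⌉-mono-≤; ⌈log₂2^n⌉≡n)
open import Data.Nat.Tactic.RingSolver using (solve-∀)
open import Data.Fin using (toℕ)
open import Data.Fin.Properties using (toℕ-injective; toℕ<n) renaming (_≟_ to _≟ᶠ_)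
open import Data.Bool using (Bool; true; false)
open import Data.Bool.Properties using (T?)
open import Data.List using ([]; _∷_; _++_; [_]; map; allFin; filterᵇ)
open import Data.List.Membership.Propositional.Properties using (∈-map⁺; ∈-map⁻; ∈-allFin; ∈-filter⁺; ∈-filter⁻)
open import Data.List.Relation.Unary.Unique.Propositional.Properties using (allFin⁺) renaming (map⁺ to unique-map⁺; filter⁺ to unique-filter⁺)
open import Data.Product using (_,_; proj₁; proj₂; ∃₂; map₂)
open import Data.Unit using (⊤; tt)
open import Data.Sum using (_⊎_; inj₁; inj₂)
open import Data.Empty using (⊥; ⊥-elim)
open import Data.List.Membership.Propositional using (_∉_)
open import Data.List.Relation.Unary.Any using (here; there)
import Data.List.Relation.Unary.All as All
open import Data.List.Relation.Unary.All.Properties using (¬Any⇒All¬)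
open import Data.List.Relation.Unary.Unique.Propositional using (Unique)
open import Data.List.Relation.Unary.AllPairs using ([]; _∷_)
open import Relation.Nullary using (¬_; Dec; yes; no; _×-dec_; ¬?)
open import Relation.Nullary.Decidable using (⌊_⌋; toWitness; fromWitness; decidable-stable)
open import Relation.Unary using (Decidable)
open import Function.Definitions using (Injective)
open import Function using (_∘_; case_of_)
open import Relation.Binary.PropositionalEquality
  using (_≡_; _≢_; refl; sym; trans; cong; subst)

module Components {n : ℕ} where

  open import Data.List.Membership.DecPropositional (_≟ᶠ_ {n}) using (_∈?_)

  merge : ℕ → ℕ → ℕ → ℕ
  merge x y z with z ≟ x
  ... | yes _ = y
  ... | no  _ = z

  merge-source : ∀ x y → merge x y x ≡ y
  merge-source x y with x ≟ x
  ... | yes _ = refl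
  ... | no x≢x = ⊥-elim (x≢x refl)

  merge-target : ∀ x y → merge x y y ≡ y
  merge-target x y with y ≟ x
  ... | yes _ = refl
  ... | no  _ = refl

  -- Component labels of the graph with edge list R: starting from distinct labels,
  -- each edge (a , b) renames the component of a to that of b.
  label : List (Edge n) → Fin n → ℕ
  label []            w = toℕ w
  label ((a , b) ∷ R) w = merge (label R a) (label R b) (label R w)

  Linked : List (Edge n) → Fin n → Fin n → Set
  Linked R x y = label R x ≡ label R y

  linked? : ∀ R x y → Dec (Linked R x y)
  linked? R x y = label R x ≟ label R y

  Spanned : List (Edge n) → Edge n → Set
  Spanned R e = Linked R (proj₁ e) (proj₂ e)

  -- Adding an edge only merges components.
  linked-weaken : ∀ e R {x y} → Linked R x y → Linked (e ∷ R) x y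
  linked-weaken (a , b) R eq = cong (merge (label R a) (label R b)) eq

  spanned-self : ∀ e R → Spanned (e ∷ R) e
  spanned-self (a , b) R = trans (merge-source (label R a) (label R b))
                                 (sym (merge-target (label R a) (label R b)))

  edge⇒linked : ∀ R {x y} → (x , y) ∈ R → Linked R x y
  edge⇒linked (e ∷ R) (here refl) = spanned-self e R
  edge⇒linked (e ∷ R) (there i)   = linked-weaken e R (edge⇒linked R i)

  adjacent⇒linked : ∀ R {x y} → Adj R x y → Linked R x y
  adjacent⇒linked R (inj₁ i) = edge⇒linked R i
  adjacent⇒linked R (inj₂ i) = sym (edge⇒linked R i)

  data Path (S : List (Edge n)) : Fin n → Fin n → Set where
    stop : ∀ x → Path S x x
    step : ∀ {x y z} → Adj S x y → Path S y z → Path S x z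

  rest : ∀ {S x y} → Path S x y → List (Fin n)
  rest (stop _)           = []
  rest (step {y = y} _ p) = y ∷ rest p

  verts : ∀ {S x y} → Path S x y → List (Fin n)
  verts {x = x} p = x ∷ rest p

  _++ₚ_ : ∀ {S x y z} → Path S x y → Path S y z → Path S x z
  stop _   ++ₚ q = q
  step a p ++ₚ q = step a (p ++ₚ q)

  adj-weaken : ∀ {e : Edge n} {R x y} → Adj R x y → Adj (e ∷ R) x y
  adj-weaken (inj₁ i) = inj₁ (there i)
  adj-weaken (inj₂ i) = inj₂ (there i)

  weaken : ∀ {e R x y} → Path R x y → Path (e ∷ R) x y
  weaken (stop x)   = stop x
  weaken (step a p) = step (adj-weaken a) (weaken p)

  rest-weaken : ∀ {e R x y} (p : Path R x y) → rest (weaken {e} p) ≡ rest p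
  rest-weaken (stop x)             = refl
  rest-weaken (step {y = y} _ p) = cong (y ∷_) (rest-weaken p)

  end∈ : ∀ {S x y} (p : Path S x y) → y ∈ verts p
  end∈ (stop _)   = here refl
  end∈ (step _ p) = there (end∈ p)

  path⇒linked : ∀ R {x y} → Path R x y → Linked R x y
  path⇒linked R (stop _)   = refl
  path⇒linked R (step a p) = trans (adjacent⇒linked R a) (path⇒linked R p)

  linked⇒path : ∀ R x y → Linked R x y → Path R x y
  linked⇒path [] x y eq with toℕ-injective eq
  ... | refl = stop x
  -- Either endpoint may lie in the component of a that was renamed; then the path
  -- goes through the new edge (a , b).
  linked⇒path ((a , b) ∷ R) x y eq with label R x ≟ label R a | label R y ≟ label R a
  ... | yes xa | yes ya = weaken (linked⇒path R x y (trans xa (sym ya)))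
  ... | yes xa | no  _  = weaken (linked⇒path R x a xa)
                          ++ₚ step (inj₁ (here refl)) (weaken (linked⇒path R b y eq))
  ... | no  _  | yes ya = weaken (linked⇒path R x b eq)
                          ++ₚ step (inj₂ (here refl)) (weaken (linked⇒path R a y (sym ya)))
  ... | no  _  | no  _  = weaken (linked⇒path R x y eq)

  SimplePath : List (Edge n) → Fin n → Fin n → Set
  SimplePath S x y = Σ (Path S x y) λ p → Unique (verts p)

  suffix : ∀ {S x y z} (q : Path S z y) → Unique (verts q) → x ∈ verts q → SimplePath S x y
  suffix q          uq       (here refl) = q , uq
  suffix (step _ q) (_ ∷ uq) (there i)   = suffix q uq i

  simplify : ∀ {S x y} → Path S x y → SimplePath S x y
  simplify (stop x) = stop x , All.[] ∷ []
  simplify {x = x} (step a p) with simplify p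
  ... | q , uq with x ∈? verts q
  ... | yes i  = suffix q uq i
  ... | no  x∉ = step a q , ¬Any⇒All¬ (verts q) x∉ ∷ uq

  path→chain : ∀ {S x y z} (p : Path S x y) → Adj S y z → Chain S (verts p ++ [ z ])
  path→chain (stop _)   b = cons b (one _)
  path→chain (step a p) b = cons a (path→chain p b)

  chain→path : ∀ {S} x ws z → Chain S (x ∷ ws ++ [ z ]) →
    Σ (Fin n) λ y → Σ (Path S x y) λ p → rest p ≡ ws × Adj S y z
  chain→path x []       z (cons b (one _)) = x , stop x , refl , b
  chain→path x (w ∷ ws) z (cons a ch) with chain→path w ws z ch
  ... | y , p , eq , b = y , step a p , cong (w ∷_) eq , b

  closed-cycle : ∀ {S x y} (p : Path S x y) → Unique (verts p) → 2 ≤ length (rest p) →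
    Adj S y x → Cycle S
  closed-cycle {x = x} p uq long b = x , rest p , long , uq , path→chain p b

  linked⇒cycle : ∀ T {a b} → (a , b) ∉ T → (b , a) ∉ T → a ≢ b → Linked T a b →
    Cycle ((a , b) ∷ T)
  linked⇒cycle T {a} {b} ab∉ ba∉ a≢b eq = close (simplify (linked⇒path T a b eq))
    where
    close : SimplePath T a b → Cycle ((a , b) ∷ T)
    close (stop _ , _)                  = ⊥-elim (a≢b refl)
    close (step (inj₁ i) (stop _) , _)  = ⊥-elim (ab∉ i)
    close (step (inj₂ i) (stop _) , _)  = ⊥-elim (ba∉ i)
    close (p@(step _ (step _ _)) , up) =
      closed-cycle (weaken p) (subst (λ vs → Unique (a ∷ vs)) (sym (rest-weaken p)) up)
                   (s≤s (s≤s z≤n)) (inj₂ (here refl))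

  data NewEdge (u v : Fin n) : Fin n → Fin n → Set where
    forward  : NewEdge u v u v
    backward : NewEdge u v v u

  classify : ∀ {R u v x y} → Adj ((u , v) ∷ R) x y → Adj R x y ⊎ NewEdge u v x y
  classify (inj₁ (here refl)) = inj₂ forward
  classify (inj₁ (there i))   = inj₁ (inj₁ i)
  classify (inj₂ (here refl)) = inj₂ backward
  classify (inj₂ (there i))   = inj₁ (inj₂ i)

  new-unlinked : ∀ {R u v x y} → ¬ Linked R u v → NewEdge u v x y → ¬ Linked R x y
  new-unlinked u≁v forward  = u≁v
  new-unlinked u≁v backward = λ v~u → u≁v (sym v~u)

  ends∈ : ∀ {u v x y} {xs : List (Fin n)} → NewEdge u v x y → x ∈ xs → y ∈ xs → u ∈ xs × v ∈ xs
  ends∈ forward  xi yi = xi , yi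
  ends∈ backward xi yi = yi , xi

  ends∋ : ∀ {u v x y} {xs : List (Fin n)} → NewEdge u v x y → u ∈ xs → v ∈ xs → x ∈ xs × y ∈ xs
  ends∋ forward  ui vi = ui , vi
  ends∋ backward ui vi = vi , ui

  partner : ∀ {u v x y w} → NewEdge u v x w → NewEdge u v y x → w ≡ y
  partner forward  forward  = refl
  partner forward  backward = refl
  partner backward forward  = refl
  partner backward backward = refl

  -- A simple path of (u , v) ∷ R either is a path of R, or it uses the new edge; then it
  -- crosses between two components of R (it cannot cross back without revisiting u or v).
  split : ∀ {R u v} → ¬ Linked R u v → ∀ {x y} (p : Path ((u , v) ∷ R) x y) → Unique (verts p) →
    (Σ (Path R x y) λ q → rest q ≡ rest p) ⊎ (¬ Linked R x y × u ∈ verts p × v ∈ verts p)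
  split u≁v (stop x) _ = inj₁ (stop x , refl)
  split {R} u≁v (step {y = w} a p) (x∉p ∷ up) with classify a | split u≁v p up
  ... | inj₁ r   | inj₁ (q , eq) = inj₁ (step r q , cong (w ∷_) eq)
  ... | inj₁ r   | inj₂ (w≁y , ui , vi) =
    inj₂ ((λ x~y → w≁y (trans (sym (adjacent⇒linked R r)) x~y)) , there ui , there vi)
  ... | inj₂ new | inj₁ (q , _) =
    inj₂ ((λ x~y → new-unlinked {R} u≁v new (trans x~y (sym (path⇒linked R q))))
         , ends∈ new (here refl) (there (here refl)))
  ... | inj₂ new | inj₂ (_ , ui , vi) = ⊥-elim (All.lookup x∉p (proj₁ (ends∋ new ui vi)) refl)

  module _ (R : List (Edge n)) {u v : Fin n} (acyclic : Acyclic R) (u≁v : ¬ Linked R u v) where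

    private
      S : List (Edge n)
      S = (u , v) ∷ R

    -- A simple path of S closed by an old edge would give a cycle of R.
    closed-by-old : ∀ {x y} (p : Path S x y) → Unique (verts p) → 2 ≤ length (rest p) →
      Adj R y x → ⊥
    closed-by-old p up long r with split u≁v p up
    ... | inj₁ (q , eq) = acyclic (closed-cycle q (subst (λ vs → Unique (_ ∷ vs)) (sym eq) up)
                                                   (subst (λ vs → 2 ≤ length vs) (sym eq) long) r)
    ... | inj₂ (x≁y , _) = x≁y (sym (adjacent⇒linked R r))

    -- A simple path of S closed by the new edge would have to link u and v in R.
    closed-by-new : ∀ {x y} (p : Path S x y) → Unique (verts p) → 2 ≤ length (rest p) →
      NewEdge u v y x → ⊥
    closed-by-new (stop _)            _ ()              _
    closed-by-new (step _ (stop _))   _ (s≤s ())        _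
    closed-by-new (step a (step b q)) (x∉ ∷ (w∉ ∷ uq)) _ new with split u≁v (step b q) (w∉ ∷ uq)
    ... | inj₂ (_ , ui , vi) = All.lookup x∉ (proj₂ (ends∋ new ui vi)) refl
    ... | inj₁ (q′ , _) with classify a
    ...   | inj₁ r    = new-unlinked {R} u≁v new (sym (trans (adjacent⇒linked R r) (path⇒linked R q′)))
    ...   | inj₂ new′ = All.lookup w∉ (end∈ q) (partner new′ new)

    acyclic-extend : Acyclic S
    acyclic-extend (x , vs , long , uq , ch) with chain→path x vs x ch
    ... | y , p , refl , closing with classify closing
    ... | inj₁ r   = closed-by-old p uq long r
    ... | inj₂ new = closed-by-new p uq long new

-- One step of the channel, classified by which stations transmit: every station k
-- holds the message g k and transmits iff P (g k).
module Channel {n m : ℕ} (g : Fin m → ℕ × Edge n) {P : ℕ × Edge n → Set} (P? : Decidable P) where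

  transmitting : List (ℕ × Edge n)
  transmitting = filterᵇ (λ q → ⌊ P? q ⌋) (map g (allFin m))

  data Outcome : Feedback n → Set where
    nobody  : (∀ k → ¬ P (g k)) → Outcome silence
    single  : ∀ k → P (g k) → (∀ j → P (g j) → j ≡ k) → Outcome (heard (proj₁ (g k)) (proj₂ (g k)))
    several : ∀ {k₁ k₂} → k₁ ≢ k₂ → P (g k₁) → P (g k₂) → Outcome collision

  member : ∀ k → P (g k) → g k ∈ transmitting
  member k pk = ∈-filter⁺ (T? ∘ λ q → ⌊ P? q ⌋) (∈-map⁺ g (∈-allFin k)) (fromWitness pk)

  sender : ∀ {q} → q ∈ transmitting → Σ (Fin m) λ k → q ≡ g k × P (g k)
  sender q∈ with ∈-filter⁻ (T? ∘ λ q → ⌊ P? q ⌋) {xs = map g (allFin m)} q∈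
  ... | q∈all , tq with ∈-map⁻ g q∈all
  ... | k , _ , refl = k , refl , toWitness tq

  only : ∀ {A : Set} {x y : A} → x ∈ y ∷ [] → x ≡ y
  only (here x≡y) = x≡y

  -- Distinct stations send distinct messages, so two transmitters give a collision.
  outcome : Injective _≡_ _≡_ g → Outcome (channel transmitting)
  outcome g-inj with transmitting in eq
                   | unique-filter⁺ (λ q → T? ⌊ P? q ⌋) (unique-map⁺ g-inj (allFin⁺ m))
  ... | [] | _ = nobody (λ k pk → case subst (g k ∈_) eq (member k pk) of λ ())
  ... | q ∷ [] | _ with sender (subst (q ∈_) (sym eq) (here refl))
  ...   | k , refl , pk = single k pk (λ j pj → g-inj (only (subst (g j ∈_) eq (member j pj))))
  outcome g-inj | q₁ ∷ q₂ ∷ _ | q₁∉ ∷ _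
    with sender (subst (q₁ ∈_) (sym eq) (here refl))
       | sender (subst (q₂ ∈_) (sym eq) (there (here refl)))
  ... | k₁ , refl , p₁ | k₂ , refl , p₂ =
    several (λ k₁≡k₂ → All.lookup q₁∉ (here refl) (cong g k₁≡k₂)) p₁ p₂

open Components

-- The algorithm scans the stations in order of ID.  The common state is a scan position L
-- (every station with ID ≤ L holds an edge spanned by the edges heard so far) and a mode.
data Mode : Set where
  check  : Mode       -- all stations above L with an unspanned edge transmit
  expand : ℕ → Mode   -- expand j: the same, restricted to the IDs in (L , L + 2 ^ j]
  bisect : ℕ → Mode   -- bisect i: two candidates lie in (L , L + 2 ^ (i + 1)]; query (L , L + 2 ^ i]
  done   : Mode

State : Set
State = ℕ × Mode

next : ∀ {n} → State → Feedback n → State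
next (L , done)         _           = L , done
next (_ , _)            (heard s _) = s , check
next (L , check)        silence     = L , done
next (L , check)        collision   = L , expand 0
next (L , expand j)     silence     = L + 2 ^ j , expand (suc j)
next (L , expand zero)  collision   = L , check      -- impossible: one ID in the window
next (L , expand (suc j)) collision = L , bisect j
next (L , bisect zero)  _           = L , check      -- impossible: see `crowded` below
next (L , bisect (suc i)) silence   = L + 2 ^ suc i , bisect i
next (L , bisect (suc i)) collision = L , bisect i

state : ∀ {n} → History n → State
state []      = 0 , check
state (f ∷ h) = next (state h) f

record-edge : ∀ {n} → Feedback n → List (Edge n) → List (Edge n)
record-edge (heard _ e) R = e ∷ R
record-edge silence     R = R
record-edge collision   R = R

heard-edges : ∀ {n} → History n → List (Edge n)
heard-edges []      = []
heard-edges (f ∷ h) = record-edge f (heard-edges h)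

InWindow : Mode → ℕ → ℕ → Set
InWindow check      L x = L < x
InWindow (expand j) L x = L < x × x ≤ L + 2 ^ j
InWindow (bisect i) L x = L < x × x ≤ L + 2 ^ i
InWindow done       L x = ⊥

inWindow? : ∀ md L x → Dec (InWindow md L x)
inWindow? check      L x = L <? x
inWindow? (expand j) L x = (L <? x) ×-dec (x ≤? L + 2 ^ j)
inWindow? (bisect i) L x = (L <? x) ×-dec (x ≤? L + 2 ^ i)
inWindow? done       L x = no λ ()

above : ∀ md {L x} → InWindow md L x → L < x
above check      L<x       = L<x
above (expand j) (L<x , _) = L<x
above (bisect i) (L<x , _) = L<x

window-down : ∀ md {L x y} → InWindow md L x → L < y → y ≤ x → InWindow md L y
window-down check      _         L<y _   = L<y
window-down (expand j) (_ , x≤U) L<y y≤x = L<y , ≤-trans y≤x x≤U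
window-down (bisect i) (_ , x≤U) L<y y≤x = L<y , ≤-trans y≤x x≤U

pinned : ∀ {a x} → a < x → x ≤ suc a → x ≡ suc a
pinned a<x x≤1+a = ≤-antisym x≤1+a a<x

Transmits : ∀ {n} → State → List (Edge n) → ℕ × Edge n → Set
Transmits (L , md) R (x , e) = InWindow md L x × ¬ Spanned R e

transmits? : ∀ {n} s (R : List (Edge n)) → Decidable (Transmits s R)
transmits? (L , md) R (x , e) = inWindow? md L x ×-dec ¬? (linked? R (proj₁ e) (proj₂ e))

isDone : Mode → Bool
isDone done = true
isDone _    = false

algorithm : Algorithm
algorithm = record
  { transmit = λ n x e h → ⌊ transmits? (state h) (heard-edges h) (x , e) ⌋
  ; halt     = λ n h → isDone (proj₂ (state h))
  }

Active : Mode → Set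
Active md = isDone md ≡ false

-- Each heard edge is charged `cost` = O(log m) steps and
-- each unit of scan progress 3 steps; `Budget md L r t` says that t steps are paid for by
-- scan position L and r heard edges, the slack terms covering the search in progress.
module Accounting (m : ℕ) where

  Λ : ℕ
  Λ = ⌈log₂ m ⌉

  cost : ℕ
  cost = 2 * Λ + 4

  data Budget : Mode → ℕ → ℕ → ℕ → Set where
    checking  : ∀ {L r t} → t ≤ 3 * L → t ≤ r * cost → Budget check L r t
    expanding : ∀ {L r t j} → 2 ^ j ≤ suc L → t + 2 * j ≤ 3 * L + 2 → t ≤ r * cost + suc j →
                Budget (expand j) L r t
    bisecting : ∀ {L r t i} → t + i ≤ 3 * L + 2 → t + i ≤ r * cost + (2 * Λ + 3) →
                Budget (bisect i) L r t
    finished  : ∀ {L r t} → t ≤ 3 * L + 1 → t ≤ r * cost + 1 → Budget done L r t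

  log-bound : ∀ {j} → 2 ^ j ≤ m → j ≤ Λ
  log-bound {j} p = subst (_≤ Λ) (⌈log₂2^n⌉≡n j) (⌈log₂⌉-mono-≤ p)

  tick : ∀ {t x} → t ≤ x → suc t ≤ x + 1
  tick {t} {x} p = subst (suc t ≤_) (+-comm 1 x) (s≤s p)

  shift : ∀ {t i x} → t + suc i ≤ x → suc t + i ≤ x
  shift {t} {i} {x} = subst (_≤ x) (+-suc t i)

  open ≤-Reasoning

  check-silence : ∀ {L r t} → Budget check L r t → Budget done L r (suc t)
  check-silence (checking scan edges) = finished (tick scan) (tick edges)

  check-collision : ∀ {L r t} → Budget check L r t → Budget (expand 0) L r (suc t)
  check-collision {L} {r} {t} (checking scan edges) = expanding (s≤s z≤n) scan′ (tick edges)
    where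
    scan′ : suc t + 0 ≤ 3 * L + 2
    scan′ = begin
      suc t + 0 ≡⟨ +-identityʳ (suc t) ⟩
      suc t     ≤⟨ tick scan ⟩
      3 * L + 1 ≤⟨ +-monoʳ-≤ (3 * L) (s≤s z≤n) ⟩
      3 * L + 2 ∎

  expand-silence : ∀ {L r t j} → Budget (expand j) L r t →
    Budget (expand (suc j)) (L + 2 ^ j) r (suc t)
  expand-silence {L} {r} {t} {j} (expanding pow scan edges) = expanding pow′ scan′ edges′
    where
    double : ∀ y → 2 * y ≡ y + y
    double = solve-∀
    regroup₁ : ∀ t j → suc t + 2 * suc j ≡ (t + 2 * j) + 3
    regroup₁ = solve-∀
    regroup₂ : ∀ L y → (3 * L + 2) + 3 * y ≡ 3 * (L + y) + 2
    regroup₂ = solve-∀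
    pow′ : 2 ^ suc j ≤ suc (L + 2 ^ j)
    pow′ = begin
      2 * 2 ^ j     ≡⟨ double (2 ^ j) ⟩
      2 ^ j + 2 ^ j ≤⟨ +-monoˡ-≤ (2 ^ j) pow ⟩
      suc L + 2 ^ j ∎
    scan′ : suc t + 2 * suc j ≤ 3 * (L + 2 ^ j) + 2
    scan′ = begin
      suc t + 2 * suc j         ≡⟨ regroup₁ t j ⟩
      (t + 2 * j) + 3           ≤⟨ +-mono-≤ scan (*-monoʳ-≤ 3 (m^n>0 2 j)) ⟩
      (3 * L + 2) + 3 * 2 ^ j   ≡⟨ regroup₂ L (2 ^ j) ⟩
      3 * (L + 2 ^ j) + 2       ∎
    edges′ : suc t ≤ r * cost + suc (suc j)
    edges′ = subst (suc t ≤_) (sym (+-suc (r * cost) (suc j))) (s≤s edges)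

  expand-collision : ∀ {L r t j} → L < m → Budget (expand (suc j)) L r t →
    Budget (bisect j) L r (suc t)
  expand-collision {L} {r} {t} {j} L<m (expanding pow scan edges) =
    bisecting (≤-trans search scan) edges′
    where
    regroup₁ : ∀ t j → t + 2 * suc j ≡ (suc t + j) + (j + 1)
    regroup₁ = solve-∀
    regroup₂ : ∀ x j → x + suc (suc j) + 1 + j ≡ x + (2 * j + 3)
    regroup₂ = solve-∀
    search : suc t + j ≤ t + 2 * suc j
    search = subst (suc t + j ≤_) (sym (regroup₁ t j)) (m≤m+n (suc t + j) (j + 1))
    depth : j ≤ Λ
    depth = log-bound (≤-trans (^-monoʳ-≤ 2 (n≤1+n j)) (≤-trans pow L<m))
    edges′ : suc t + j ≤ r * cost + (2 * Λ + 3)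
    edges′ = begin
      suc t + j                          ≤⟨ +-monoˡ-≤ j (tick edges) ⟩
      r * cost + suc (suc j) + 1 + j     ≡⟨ regroup₂ (r * cost) j ⟩
      r * cost + (2 * j + 3)             ≤⟨ +-monoʳ-≤ (r * cost) (+-monoˡ-≤ 3 (*-monoʳ-≤ 2 depth)) ⟩
      r * cost + (2 * Λ + 3)             ∎

  bisect-silence : ∀ {L r t i} → Budget (bisect (suc i)) L r t →
    Budget (bisect i) (L + 2 ^ suc i) r (suc t)
  bisect-silence {L} (bisecting scan edges) =
    bisecting (≤-trans (shift scan) (+-monoˡ-≤ 2 (*-monoʳ-≤ 3 (m≤m+n L _)))) (shift edges)

  bisect-collision : ∀ {L r t i} → Budget (bisect (suc i)) L r t → Budget (bisect i) L r (suc t)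
  bisect-collision (bisecting scan edges) = bisecting (shift scan) (shift edges)

  active-scan : ∀ md {L r t} → Active md → Budget md L r t → t ≤ 3 * L + 2
  active-scan check      _ (checking scan _)    = ≤-trans scan (m≤m+n _ 2)
  active-scan (expand j) _ (expanding _ scan _) = ≤-trans (m≤m+n _ (2 * j)) scan
  active-scan (bisect i) _ (bisecting scan _)   = ≤-trans (m≤m+n _ i) scan

  active-edges : ∀ md {L r t} → Active md → L < m → Budget md L r t → t ≤ r * cost + (2 * Λ + 3)
  active-edges check      _ _ (checking _ edges) = ≤-trans edges (m≤m+n _ _)
  active-edges (expand j) {r = r} _ L<m (expanding pow _ edges) =
    ≤-trans edges (+-monoʳ-≤ (r * cost) (≤-trans (s≤s (log-bound (≤-trans pow L<m))) slack))
    where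
    slack : suc Λ ≤ 2 * Λ + 3
    slack = subst (suc Λ ≤_) (sym (regroup Λ)) (m≤m+n (suc Λ) (Λ + 2))
      where
      regroup : ∀ x → 2 * x + 3 ≡ suc x + (x + 2)
      regroup = solve-∀
  active-edges (bisect i) _ _ (bisecting _ edges) = ≤-trans (m≤m+n _ i) edges

  found : ∀ md {L r t s} → Active md → L < s → s ≤ m → Budget md L r t →
    Budget check s (suc r) (suc t)
  found md {L} {r} {t} {s} act L<s s≤m b = checking scan′ edges′
    where
    regroup₁ : ∀ L → suc (3 * L + 2) ≡ 3 * suc L
    regroup₁ = solve-∀
    regroup₂ : ∀ x Λ → suc (x + (2 * Λ + 3)) ≡ (2 * Λ + 4) + x
    regroup₂ = solve-∀
    scan′ : suc t ≤ 3 * s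
    scan′ = begin
      suc t               ≤⟨ s≤s (active-scan md act b) ⟩
      suc (3 * L + 2)     ≡⟨ regroup₁ L ⟩
      3 * suc L           ≤⟨ *-monoʳ-≤ 3 L<s ⟩
      3 * s               ∎
    edges′ : suc t ≤ suc r * cost
    edges′ = begin
      suc t                           ≤⟨ s≤s (active-edges md act (<-≤-trans L<s s≤m) b) ⟩
      suc (r * cost + (2 * Λ + 3))    ≡⟨ regroup₂ (r * cost) Λ ⟩
      cost + r * cost                 ∎

  -- The final bound, with constant 7: O(m) by the scan, O(r log m) by the edges.
  finish : ∀ {L r t} → L ≤ m → Budget done L r t → t ≤ 7 * (m ⊓ (r * Λ)) + 7
  finish {L} {r} {t} L≤m (finished scan edges) with m ≤? 1
  ... | yes m≤1 = ≤-trans scan (≤-trans small (m≤n+m 7 _))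
    where
    small : 3 * L + 1 ≤ 7
    small = ≤-trans (+-monoˡ-≤ 1 (*-monoʳ-≤ 3 (≤-trans L≤m m≤1))) (m≤m+n 4 3)
  ... | no m≰1 = under-min by-scan by-edges
    where
    under-min : t ≤ 7 * m + 7 → t ≤ 7 * (r * Λ) + 7 → t ≤ 7 * (m ⊓ (r * Λ)) + 7
    under-min p q with ⊓-sel m (r * Λ)
    ... | inj₁ e = subst (λ z → t ≤ 7 * z + 7) (sym e) p
    ... | inj₂ e = subst (λ z → t ≤ 7 * z + 7) (sym e) q
    by-scan : t ≤ 7 * m + 7
    by-scan = begin
      t             ≤⟨ scan ⟩
      3 * L + 1     ≤⟨ +-mono-≤ (*-mono-≤ (m≤m+n 3 4) L≤m) (m≤m+n 1 6) ⟩
      7 * m + 7     ∎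
    regroup₁ : ∀ x → 2 * x + 5 * x ≡ 7 * x
    regroup₁ = solve-∀
    regroup₂ : ∀ r x → r * (7 * x) ≡ 7 * (r * x)
    regroup₂ = solve-∀
    cheap : cost ≤ 7 * Λ
    cheap = begin
      2 * Λ + 4     ≤⟨ +-monoʳ-≤ (2 * Λ) (≤-trans (n≤1+n 4) (*-monoʳ-≤ 5 (log-bound {1} (≰⇒> m≰1)))) ⟩
      2 * Λ + 5 * Λ ≡⟨ regroup₁ Λ ⟩
      7 * Λ         ∎
    by-edges : t ≤ 7 * (r * Λ) + 7
    by-edges = begin
      t                   ≤⟨ edges ⟩
      r * cost + 1        ≤⟨ +-mono-≤ (*-monoʳ-≤ r cheap) (m≤m+n 1 6) ⟩
      r * (7 * Λ) + 7     ≡⟨ cong (_+ 7) (regroup₂ r Λ) ⟩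
      7 * (r * Λ) + 7     ∎

heard-revealed : ∀ {n} (h : History n) e → e ∈ heard-edges h → Revealed e h
heard-revealed (heard i _ ∷ h) e (here refl) = i , here refl
heard-revealed (heard _ _ ∷ h) e (there e∈) = map₂ there (heard-revealed h e e∈)
heard-revealed (silence   ∷ h) e e∈         = map₂ there (heard-revealed h e e∈)
heard-revealed (collision ∷ h) e e∈         = map₂ there (heard-revealed h e e∈)

first-true : (f : ℕ → Bool) → ∀ k →
  (Σ ℕ λ t → f t ≡ true × (∀ t′ → t′ < t → f t′ ≡ false)) ⊎ (∀ t′ → t′ < k → f t′ ≡ false)
first-true f zero = inj₂ λ _ ()
first-true f (suc k) with first-true f k
... | inj₁ found = inj₁ found
... | inj₂ none with f k in fk
...   | true  = inj₁ (k , fk , none)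
...   | false = inj₂ λ t′ t′<1+k → case m<1+n⇒m<n∨m≡n t′<1+k of λ where
        (inj₁ t′<k)  → none t′ t′<k
        (inj₂ refl) → fk

module Run (n m : ℕ) (E : Fin m → Edge n) (valid : ValidInput E) where

  open Accounting m

  ID : Fin m → ℕ
  ID k = suc (toℕ k)

  ID-injective : ∀ {k₁ k₂} → ID k₁ ≡ ID k₂ → k₁ ≡ k₂
  ID-injective e = toℕ-injective (suc-injective e)

  station : Fin m → ℕ × Edge n
  station k = ID k , E k

  station-injective : Injective _≡_ _≡_ station
  station-injective same = ID-injective (cong proj₁ same)

  open Channel station using (Outcome; nobody; single; several; outcome)

  Candidate : Mode → ℕ → List (Edge n) → Fin m → Set
  Candidate md L R k = Transmits (L , md) R (station k)

  -- What the common history has established about the unscanned stations.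
  Knowledge : Mode → ℕ → List (Edge n) → Set
  Knowledge check      L R = ⊤
  Knowledge (expand j) L R = ∃ λ k → Candidate check L R k
  Knowledge (bisect i) L R = ∃₂ λ k₁ k₂ → k₁ ≢ k₂ ×
                               Candidate (bisect (suc i)) L R k₁ × Candidate (bisect (suc i)) L R k₂
  Knowledge done       L R = ∀ k → Spanned R (E k)

  record Forest (R : List (Edge n)) : Set where
    field
      in-graph : ∀ e → e ∈ R → InGraph E e
      distinct : Unique R
      acyclic  : Acyclic R

  record Invariant (s : State) (R : List (Edge n)) (t : ℕ) : Set where
    field
      forest    : Forest R
      scanned   : ∀ k → ID k ≤ proj₁ s → Spanned R (E k)
      within    : proj₁ s ≤ m
      knowledge : Knowledge (proj₂ s) (proj₁ s) R
      budget    : Budget (proj₂ s) (proj₁ s) (length R) t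

  initial : Invariant (0 , check) [] 0
  initial = record
    { forest    = record { in-graph = λ _ () ; distinct = [] ; acyclic = acyclic-[] }
    ; scanned   = λ _ ()
    ; within    = z≤n
    ; knowledge = tt
    ; budget    = checking z≤n z≤n
    }
    where
    acyclic-[] : Acyclic {n} []
    acyclic-[] (_ , [] , () , _)
    acyclic-[] (_ , _ ∷ _ , _ , _ , cons (inj₁ ()) _)
    acyclic-[] (_ , _ ∷ _ , _ , _ , cons (inj₂ ()) _)

  Silent : Mode → ℕ → List (Edge n) → Set
  Silent md L R = ∀ k → ¬ Candidate md L R k

  -- Stations of a silent window hold spanned edges, so the scan may skip the window ...
  skip : ∀ md {L L′} R → (∀ k → ID k ≤ L → Spanned R (E k)) → Silent md L R →
    (∀ {x} → L < x → x ≤ L′ → InWindow md L x) → ∀ k → ID k ≤ L′ → Spanned R (E k)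
  skip md {L} R scanned silent covered k k≤L′ with ID k ≤? L
  ... | yes k≤L = scanned k k≤L
  ... | no  k≰L = decidable-stable (linked? R _ _) λ ¬spanned →
                    silent k (covered (≰⇒> k≰L) k≤L′ , ¬spanned)

  beyond : ∀ md {L U} R {k} → Silent md L R → (∀ {x} → L < x → x ≤ U → InWindow md L x) →
    L < ID k → ¬ Spanned R (E k) → U < ID k
  beyond md {U = U} R {k} silent covered L<k ¬spanned with ID k ≤? U
  ... | yes k≤U = ⊥-elim (silent k (covered L<k k≤U , ¬spanned))
  ... | no  k≰U = ≰⇒> k≰U

  grow : ∀ {R} → Forest R → ∀ k → ¬ Spanned R (E k) → Forest (E k ∷ R)
  grow {R} F k unspanned = record
    { in-graph = in-graph′
    ; distinct = ¬Any⇒All¬ R (λ k∈R → unspanned (edge⇒linked R k∈R)) ∷ distinct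
    ; acyclic  = acyclic-extend R acyclic unspanned
    }
    where
    open Forest F
    in-graph′ : ∀ e → e ∈ E k ∷ R → InGraph E e
    in-graph′ e (here refl) = k , refl
    in-graph′ e (there e∈R) = in-graph e e∈R

  -- Hearing the first candidate: its edge extends the forest, and every station up to its
  -- sender is now spanned (the others in the window stayed silent, so were spanned).
  hear : ∀ md {L R t} → Active md → Invariant (L , md) R t → ∀ k → Candidate md L R k →
    (∀ j → Candidate md L R j → j ≡ k) → Invariant (ID k , check) (E k ∷ R) (suc t)
  hear md {L} {R} act I k (in-window , unspanned) only = record
    { forest    = grow forest k unspanned
    ; scanned   = scanned′
    ; within    = toℕ<n k
    ; knowledge = tt
    ; budget    = found md act (above md in-window) (toℕ<n k) budget
    }
    where
    open Invariant I
    scanned′ : ∀ j → ID j ≤ ID k → Spanned (E k ∷ R) (E j)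
    scanned′ j j≤k with ID j ≤? L | linked? R (proj₁ (E j)) (proj₂ (E j))
    ... | yes j≤L | _           = linked-weaken (E k) R (scanned j j≤L)
    ... | no  _   | yes spanned = linked-weaken (E k) R spanned
    ... | no  j≰L | no  ¬spanned =
      subst (λ i → Spanned (E k ∷ R) (E i))
            (sym (only j (window-down md in-window (≰⇒> j≰L) j≤k , ¬spanned)))
            (spanned-self (E k) R)

  check-silent : ∀ {L R t} → Invariant (L , check) R t → Silent check L R →
    Invariant (L , done) R (suc t)
  check-silent {R = R} I silent = record
    { forest    = forest
    ; scanned   = scanned
    ; within    = within
    ; knowledge = λ k → skip check R scanned silent (λ L<x _ → L<x) k (toℕ<n k)
    ; budget    = check-silence budget
    }
    where open Invariant I

  check-collide : ∀ {L R t k} → Invariant (L , check) R t → Candidate check L R k →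
    Invariant (L , expand 0) R (suc t)
  check-collide {k = k} I candidate = record
    { forest    = forest
    ; scanned   = scanned
    ; within    = within
    ; knowledge = k , candidate
    ; budget    = check-collision budget
    }
    where open Invariant I

  expand-silent : ∀ {L R t j} → Invariant (L , expand j) R t → Silent (expand j) L R →
    Invariant (L + 2 ^ j , expand (suc j)) R (suc t)
  expand-silent {R = R} {j = j} I silent = record
    { forest    = forest
    ; scanned   = skip (expand j) R scanned silent _,_
    ; within    = <⇒≤ (<-≤-trans past (toℕ<n k))
    ; knowledge = k , past , unspanned
    ; budget    = expand-silence budget
    }
    where
    open Invariant I
    k = proj₁ knowledge
    unspanned = proj₂ (proj₂ knowledge)
    past = beyond (expand j) R silent _,_ (proj₁ (proj₂ knowledge)) unspanned

  expand-collide : ∀ {L R t j k₁ k₂} → Invariant (L , expand (suc j)) R t → k₁ ≢ k₂ →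
    Candidate (expand (suc j)) L R k₁ → Candidate (expand (suc j)) L R k₂ →
    Invariant (L , bisect j) R (suc t)
  expand-collide {k₁ = k₁} {k₂} I k₁≢k₂ c₁ c₂ = record
    { forest    = forest
    ; scanned   = scanned
    ; within    = within
    ; knowledge = k₁ , k₂ , k₁≢k₂ , c₁ , c₂
    ; budget    = expand-collision (<-≤-trans (proj₁ (proj₁ c₁)) (toℕ<n k₁)) budget
    }
    where open Invariant I

  bisect-silent : ∀ {L R t i} → Invariant (L , bisect (suc i)) R t → Silent (bisect (suc i)) L R →
    Invariant (L + 2 ^ suc i , bisect i) R (suc t)
  bisect-silent {L} {R} {i = i} I silent = record
    { forest    = forest
    ; scanned   = skip (bisect (suc i)) R scanned silent _,_
    ; within    = <⇒≤ (<-≤-trans (proj₁ (proj₁ upper₁)) (toℕ<n k₁))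
    ; knowledge = k₁ , k₂ , k₁≢k₂ , upper₁ , upper₂
    ; budget    = bisect-silence budget
    }
    where
    open Invariant I
    k₁ = proj₁ knowledge
    k₂ = proj₁ (proj₂ knowledge)
    k₁≢k₂ = proj₁ (proj₂ (proj₂ knowledge))
    halves : ∀ L y → L + 2 * y ≡ (L + y) + y
    halves = solve-∀
    upper : ∀ {k} → Candidate (bisect (suc (suc i))) L R k → Candidate (bisect (suc i)) (L + 2 ^ suc i) R k
    upper {k} ((L<k , k≤U) , unspanned) =
      (beyond (bisect (suc i)) R silent _,_ L<k unspanned , subst (ID k ≤_) (halves L (2 ^ suc i)) k≤U)
      , unspanned
    upper₁ = upper (proj₁ (proj₂ (proj₂ (proj₂ knowledge))))
    upper₂ = upper (proj₂ (proj₂ (proj₂ (proj₂ knowledge))))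

  bisect-collide : ∀ {L R t i k₁ k₂} → Invariant (L , bisect (suc i)) R t → k₁ ≢ k₂ →
    Candidate (bisect (suc i)) L R k₁ → Candidate (bisect (suc i)) L R k₂ →
    Invariant (L , bisect i) R (suc t)
  bisect-collide {k₁ = k₁} {k₂} I k₁≢k₂ c₁ c₂ = record
    { forest    = forest
    ; scanned   = scanned
    ; within    = within
    ; knowledge = k₁ , k₂ , k₁≢k₂ , c₁ , c₂
    ; budget    = bisect-collision budget
    }
    where open Invariant I

  -- The windows (L , L + 1] of expand 0 and bisect 0 hold at most one station ...
  unit-window : ∀ {L k₁ k₂} → L < ID k₁ × ID k₁ ≤ L + 1 → L < ID k₂ × ID k₂ ≤ L + 1 → k₁ ≡ k₂
  unit-window {L} (L<k₁ , k₁≤) (L<k₂ , k₂≤) = ID-injective (trans (pin L<k₁ k₁≤) (sym (pin L<k₂ k₂≤)))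
    where
    pin : ∀ {x} → L < x → x ≤ L + 1 → x ≡ suc L
    pin {x} L<x x≤ = pinned L<x (subst (x ≤_) (+-comm L 1) x≤)

  -- ... so in bisect 0 the lower window cannot be silent: both candidates would be L + 2.
  crowded : ∀ {L R t} → Invariant (L , bisect zero) R t → ¬ Silent (bisect zero) L R
  crowded {L} {R} I silent with Invariant.knowledge I
  ... | _ , _ , k₁≢k₂ , c₁ , c₂ = k₁≢k₂ (ID-injective (trans (at-top c₁) (sym (at-top c₂))))
    where
    at-top : ∀ {k} → Candidate (bisect 1) L R k → ID k ≡ suc (L + 1)
    at-top {k} ((L<k , k≤) , unspanned) =
      pinned (beyond (bisect zero) R silent _,_ L<k unspanned) (subst (ID k ≤_) (+-suc L 1) k≤)

  advance : ∀ md {L R t f} → Active md → Invariant (L , md) R t → Outcome (transmits? (L , md) R) f →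
    Invariant (next (L , md) f) (record-edge f R) (suc t)
  advance md@check           act I (single k c only)     = hear md act I k c only
  advance md@(expand _)      act I (single k c only)     = hear md act I k c only
  advance md@(bisect _)      act I (single k c only)     = hear md act I k c only
  advance check              _   I (nobody silent)       = check-silent I silent
  advance check              _   I (several _ c₁ _)      = check-collide I c₁
  advance (expand _)         _   I (nobody silent)       = expand-silent I silent
  advance (expand zero)      _   I (several k₁≢k₂ c₁ c₂) = ⊥-elim (k₁≢k₂ (unit-window (proj₁ c₁) (proj₁ c₂)))
  advance (expand (suc _))   _   I (several k₁≢k₂ c₁ c₂) = expand-collide I k₁≢k₂ c₁ c₂
  advance (bisect zero)      _   I (nobody silent)       = ⊥-elim (crowded I silent)
  advance (bisect zero)      _   I (several k₁≢k₂ c₁ c₂) = ⊥-elim (k₁≢k₂ (unit-window (proj₁ c₁) (proj₁ c₂)))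
  advance (bisect (suc _))   _   I (nobody silent)       = bisect-silent I silent
  advance (bisect (suc _))   _   I (several k₁≢k₂ c₁ c₂) = bisect-collide I k₁≢k₂ c₁ c₂
  advance done               ()  _ _

  run : ℕ → History n
  run = history algorithm n m E

  Halted : ℕ → Bool
  Halted t = halt algorithm n (run t)

  invariant : ∀ t → (∀ t′ → t′ < t → Halted t′ ≡ false) →
    Invariant (state (run t)) (heard-edges (run t)) t
  invariant zero    _      = initial
  invariant (suc t) before =
    advance (proj₂ (state (run t))) (before t ≤-refl)
         (invariant t (λ t′ t′<t → before t′ (m<n⇒m<1+n t′<t)))
         (outcome (transmits? (state (run t)) (heard-edges (run t))) station-injective)

  -- The run halts within 3 m + 3 steps, since an active run has t ≤ 3 L + 2 ≤ 3 m + 2.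
  terminates : Σ ℕ λ t → TerminatesAt algorithm n m E t
  terminates with first-true Halted (suc (3 * m + 3))
  ... | inj₁ (t , halted , before) = t , halted , before
  ... | inj₂ never = ⊥-elim (<-irrefl refl (subst (_≤ 3 * m + 2) (+-suc (3 * m) 2) late))
    where
    I = invariant (3 * m + 3) (λ t′ t′<T → never t′ (m<n⇒m<1+n t′<T))
    late : 3 * m + 3 ≤ 3 * m + 2
    late = ≤-trans (active-scan _ (never (3 * m + 3) ≤-refl) (Invariant.budget I))
                   (+-monoˡ-≤ 2 (*-monoʳ-≤ 3 (Invariant.within I)))

  -- Input edges are normalised, so neither a reversed input edge nor a loop is an input edge.
  ordered : ∀ k → toℕ (proj₁ (E k)) < toℕ (proj₂ (E k))
  ordered = proj₁ valid

  reversed∉ : ∀ {R} → Forest R → ∀ k → (proj₂ (E k) , proj₁ (E k)) ∉ R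
  reversed∉ F k ba∈R with Forest.in-graph F _ ba∈R
  ... | k′ , E-k′≡ba =
    <-asym (ordered k) (subst (λ e → toℕ (proj₁ e) < toℕ (proj₂ e)) E-k′≡ba (ordered k′))

  no-loop : ∀ k → proj₁ (E k) ≢ proj₂ (E k)
  no-loop k a≡b = <-irrefl (cong toℕ a≡b) (ordered k)

  result : ∀ {s R t} → isDone (proj₂ s) ≡ true → Invariant s R t →
    SpanningForest E R × t ≤ 7 * (m ⊓ (length R * ⌈log₂ m ⌉)) + 7
  result {_ , done} {R} _ I = (distinct , in-graph , acyclic , maximal) , finish within budget
    where
    open Invariant I
    open Forest forest
    maximal : ∀ e → InGraph E e → e ∉ R → Cycle (e ∷ R)
    maximal _ (k , refl) k∉R = linked⇒cycle R k∉R (reversed∉ forest k) (no-loop k) (knowledge k)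
  result {_ , check}    () _
  result {_ , expand _} () _
  result {_ , bisect _} () _

  main : ∃ λ (t : ℕ) → TerminatesAt algorithm n m E t ×
      Σ (List (Edge n)) λ T → SpanningForest E T ×
        (∀ e → e ∈ T → Revealed e (history algorithm n m E t)) ×
        t ≤ 7 * (m ⊓ (length T * ⌈log₂ m ⌉)) + 7
  main with terminates
  ... | t , halted , before with result halted (invariant t before)
  ...   | spanning , bound =
    t , (halted , before) , heard-edges (run t) , spanning , heard-revealed (run t) , bound

theorem1 : Σ Algorithm λ A → ∃ λ (c : ℕ) →
    ∀ (n m : ℕ) (E : Fin m → Edge n) → ValidInput E →
    ∃ λ (t : ℕ) → TerminatesAt A n m E t ×
      Σ (List (Edge n)) λ T → SpanningForest E T ×
        (∀ e → e ∈ T → Revealed e (history A n m E t)) ×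
        t ≤ c * (m ⊓ (length T * ⌈log₂ m ⌉)) + c
theorem1 = algorithm , 7 , Run.main
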